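{- For every integer $n\ge 3$, every edge of the Cartesian product graph $K_2\,\square\,K_{n-1}$ is contained in at least $(n-2)!\,(n-3)!$ distinct Hamiltonian cycles of $K_2\,\square\,K_{n-1}$. -}

module Defs where

open import Data.Nat using (ℕ; _+_; _*_; _∸_; suc)
open import Data.Fin using (Fin; toℕ)
open import Data.Product using (_×_; Σ; ∃; proj₁; proj₂; _,_)
open import Data.Sum using (_⊎_)
open import Data.Bool using (Bool; true)
open import Relation.Binary.PropositionalEquality using (_≡_; _≢_)
open import Function using (_⇔_)

V : ℕ → Set
V m = Fin 2 × Fin m

Adj : (m : ℕ) → V m → V m → Set
Adj m u v = (proj₁ u ≡ proj₁ v × proj₂ u ≢ proj₂ v)
          ⊎ (proj₁ u ≢ proj₁ v × proj₂ u ≡ proj₂ v)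

CycSucc : (N : ℕ) → Fin N → Fin N → Set
CycSucc N i j = (toℕ j ≡ suc (toℕ i)) ⊎ (suc (toℕ i) ≡ N × toℕ j ≡ 0)

-- A spanning subgraph given by its (symmetric) edge indicator.
EdgeSet : ℕ → Set
EdgeSet m = V m → V m → Bool

IsHamCycle : (m : ℕ) → EdgeSet m → Set
IsHamCycle m E =
  Σ (Fin (2 * m) → V m) λ σ →
      (∀ i j → σ i ≡ σ j → i ≡ j)
    × (∀ v → ∃ λ i → σ i ≡ v)
    × (∀ i j → CycSucc (2 * m) i j → Adj m (σ i) (σ j))
    × (∀ u v → (E u v ≡ true) ⇔
         (∃ λ i → ∃ λ j → CycSucc (2 * m) i j ×
            ((u ≡ σ i × v ≡ σ j) ⊎ (v ≡ σ i × u ≡ σ j))))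

-- Label the vertices of K₂ □ K_m (m = n − 1 = k + 2) as (ℓ , c) with layer ℓ ∈ Fin 2 and
-- column c ∈ Fin m. Permuting layers and columns are automorphisms, and they move any rung
-- to (1,0)(0,0) and any layer edge to (0,0)(0,1), so only these two edges need treatment.
-- For each we exhibit (k + 1) · k! · k! = (n − 2)! (n − 3)! Hamiltonian cycles that change
-- layer exactly twice: through the rung, choose the other crossing column (k + 1 ways) and
-- the orders of the remaining columns within each layer (k! each); through the layer edge,
-- choose an order of the k columns other than 0 and 1, where to insert the block 0 1 in it
-- (k + 1 ways), and the order of the interior columns in layer 1 (k!). The cycles are given
-- by vertex lists, and they are distinct because a Hamiltonian cycle together with a
-- directed edge on it determines its vertex list starting with that edge.

module Submission where

open import Defs
open import Data.Nat using (ℕ; zero; suc; _<_; _≤_; z≤n; s≤s; _+_; _*_; _∸_; _!)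
import Data.Nat as ℕ
open import Data.Nat.Properties
  using (suc-injective; ≤-pred; <⇒≤; ≤-reflexive; +-comm; +-identityʳ; <-irrefl; n<1+n; <-trans; m≤n⇒m⊓n≡m)
open import Data.Fin using (Fin; toℕ; fromℕ<; remQuot; combine)
import Data.Fin as Fin
open import Data.Fin.Patterns using (0F; 1F)
open import Data.Fin.Properties using (toℕ-injective; toℕ<n; toℕ-fromℕ<; combine-remQuot; _≟_)
open import Data.Fin.Permutation using (Permutation′; transpose; _∘ₚ_; _⟨$⟩ʳ_; _⟨$⟩ˡ_; inverseˡ; inverseʳ)
import Data.Fin.Permutation.Components as PC
open import Data.Product using (Σ; ∃; _×_; _,_; proj₁; proj₂; uncurry)
open import Data.Sum using (_⊎_; inj₁; inj₂)
open import Data.Unit using (⊤)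
open import Data.Empty using (⊥-elim)
open import Data.Bool using (true)
open import Data.List
  using (List; []; _∷_; _++_; [_]; _∷ʳ_; length; map; allFin; tabulate; take; drop; cartesianProduct)
open import Data.List.Properties
  using (map-++; ++-assoc; ++-identityʳ; length-++; length-map; length-tabulate; length-take; take++drop≡id;
         map-injective; ∷-injective; ∷-injectiveˡ; ∷-injectiveʳ; ∷ʳ-injective)
import Data.List.Relation.Unary.All as All
open import Data.List.Relation.Unary.Any using (here; there)
open import Data.List.Relation.Unary.AllPairs using (_∷_; tail)
open import Data.List.Relation.Unary.Linked as Linked using (Linked; [-]; _∷_)
import Data.List.Relation.Unary.Linked.Properties as Linked
open import Data.List.Relation.Unary.Unique.Propositional using (Unique)
import Data.List.Relation.Unary.Unique.Propositional.Properties as Unique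
open import Data.List.Membership.Propositional using (_∈_)
open import Data.List.Membership.Propositional.Properties using (∈-allFin; ∈-cartesianProduct⁺; ∈-map⁺)
open import Data.List.Relation.Binary.Permutation.Propositional
  using (_↭_; ↭-refl; ↭-prep; ↭-swap; ↭-trans; ↭-sym; ↭-reflexive; ↭⇒↭ₛ; module PermutationReasoning)
import Data.List.Relation.Binary.Permutation.Propositional.Properties as ↭
import Data.List.Relation.Binary.Permutation.Setoid.Properties as ↭ₛ
open import Relation.Binary.PropositionalEquality hiding ([_])
open import Relation.Nullary using (Dec; does; yes; no)
open import Relation.Nullary.Decidable using (dec-true; dec-false; _⊎-dec_; _×-dec_)
open import Function using (_∘_)
open import Function.Bundles using (mk⇔)

private variable A : Set

module _ {R : A → A → Set} where

  Linked-++-∷⁺ : ∀ xs {y ys} → Linked R (xs ∷ʳ y) → Linked R (y ∷ ys) → Linked R (xs ++ y ∷ ys)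
  Linked-++-∷⁺ []            _          l = l
  Linked-++-∷⁺ (x ∷ [])      (r ∷ [-])  l = r ∷ l
  Linked-++-∷⁺ (x ∷ x′ ∷ xs) (r ∷ rs)   l = r ∷ Linked-++-∷⁺ (x′ ∷ xs) rs l

  Linked-++-∷⁻ : ∀ xs {y ys} → Linked R (xs ++ y ∷ ys) → Linked R (xs ∷ʳ y) × Linked R (y ∷ ys)
  Linked-++-∷⁻ []            l       = [-] , l
  Linked-++-∷⁻ (x ∷ [])      (r ∷ l) = r ∷ [-] , l
  Linked-++-∷⁻ (x ∷ x′ ∷ xs) (r ∷ l) = let p , q = Linked-++-∷⁻ (x′ ∷ xs) l in r ∷ p , q

  Linked-bridge : ∀ xs {x y ys} → Linked R (xs ∷ʳ x) → R x y → Linked R (y ∷ ys) →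
                  Linked R (xs ++ x ∷ y ∷ ys)
  Linked-bridge xs l r l′ = Linked-++-∷⁺ xs l (r ∷ l′)

CyclicallyLinked : (A → A → Set) → List A → Set
CyclicallyLinked R []       = ⊤
CyclicallyLinked R (x ∷ xs) = Linked R (x ∷ xs ∷ʳ x)

CyclicallyLinked-map : ∀ {B : Set} {R : A → A → Set} {S : B → B → Set} {f : A → B} →
                       (∀ {x y} → R x y → S (f x) (f y)) →
                       ∀ xs → CyclicallyLinked R xs → CyclicallyLinked S (map f xs)
CyclicallyLinked-map         f-hom []       _ = _
CyclicallyLinked-map {f = f} f-hom (x ∷ xs) l =
  subst (Linked _) (cong (f x ∷_) (map-++ f xs [ x ])) (Linked.map⁺ (Linked.map f-hom l))

CyclicallyLinked-rotate : ∀ {R : A → A → Set} xs ys →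
                          CyclicallyLinked R (xs ++ ys) → CyclicallyLinked R (ys ++ xs)
CyclicallyLinked-rotate []       ys c rewrite ++-identityʳ ys = c
CyclicallyLinked-rotate (x ∷ xs) [] c rewrite ++-identityʳ xs = c
CyclicallyLinked-rotate {R = R} (x ∷ xs) (y ∷ ys) c =
  let xy , yx = Linked-++-∷⁻ (x ∷ xs) (subst (Linked R) (cong (x ∷_) (++-assoc xs (y ∷ ys) [ x ])) c)
  in subst (Linked R) (cong (y ∷_) (sym (++-assoc ys (x ∷ xs) [ y ]))) (Linked-++-∷⁺ (y ∷ ys) yx xy)

Unique-resp-↭ : ∀ {xs ys : List A} → xs ↭ ys → Unique xs → Unique ys
Unique-resp-↭ {A = A} p = ↭ₛ.Unique-resp-↭ (setoid A) (↭⇒↭ₛ p)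

++-injective : ∀ (xs xs′ : List A) {ys ys′} → length xs ≡ length xs′ →
               xs ++ ys ≡ xs′ ++ ys′ → xs ≡ xs′ × ys ≡ ys′
++-injective []       []         _  eq = refl , eq
++-injective (x ∷ xs) (x′ ∷ xs′) ℓ eq =
  let x≡x′ , eq′ = ∷-injective eq
      xs≡ , ys≡ = ++-injective xs xs′ (suc-injective ℓ) eq′
  in cong₂ _∷_ x≡x′ xs≡ , ys≡

length-∷ʳ : ∀ (xs : List A) {x} → length (xs ∷ʳ x) ≡ suc (length xs)
length-∷ʳ []       = refl
length-∷ʳ (_ ∷ xs) = cong suc (length-∷ʳ xs)

headTail-∷ʳ : List A → A → A × List A
headTail-∷ʳ []       z = z , []
headTail-∷ʳ (x ∷ xs) z = x , xs ∷ʳ z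

headTail-∷ʳ-≡ : ∀ (xs : List A) z → xs ∷ʳ z ≡ proj₁ (headTail-∷ʳ xs z) ∷ proj₂ (headTail-∷ʳ xs z)
headTail-∷ʳ-≡ []       z = refl
headTail-∷ʳ-≡ (x ∷ xs) z = refl

initLast-∷ : A → List A → List A × A
initLast-∷ z []       = [] , z
initLast-∷ z (y ∷ ys) = let zs , w = initLast-∷ y ys in z ∷ zs , w

initLast-∷-≡ : ∀ (z : A) ys → z ∷ ys ≡ proj₁ (initLast-∷ z ys) ∷ʳ proj₂ (initLast-∷ z ys)
initLast-∷-≡ z []       = refl
initLast-∷-≡ z (y ∷ ys) = cong (z ∷_) (initLast-∷-≡ y ys)

∷-∷ʳ-↭ : ∀ {xs ys : List A} {x y} → ys ↭ xs → y ∷ ys ∷ʳ x ↭ x ∷ xs ∷ʳ y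
∷-∷ʳ-↭ {xs = xs} {ys} {x} {y} p = begin
  y ∷ ys ∷ʳ x  ↭⟨ ↭-prep y (↭-sym (↭.∷↭∷ʳ x ys)) ⟩
  y ∷ x ∷ ys   ↭⟨ ↭-swap y x p ⟩
  x ∷ y ∷ xs   ↭⟨ ↭-prep x (↭.∷↭∷ʳ y xs) ⟩
  x ∷ xs ∷ʳ y  ∎
  where open PermutationReasoning

nth : A → List A → ℕ → A
nth d []       _       = d
nth d (x ∷ xs) zero    = x
nth d (x ∷ xs) (suc i) = nth d xs i

module _ (d : A) where

  nth-∈ : ∀ xs {i} → i < length xs → nth d xs i ∈ xs
  nth-∈ (x ∷ xs) {zero}  _       = here refl
  nth-∈ (x ∷ xs) {suc i} (s≤s p) = there (nth-∈ xs p)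

  ∈⇒nth : ∀ {x} xs → x ∈ xs → Σ ℕ λ i → i < length xs × nth d xs i ≡ x
  ∈⇒nth (x ∷ xs) (here refl) = 0 , s≤s z≤n , refl
  ∈⇒nth (x ∷ xs) (there p)   = let i , i< , eq = ∈⇒nth xs p in suc i , s≤s i< , eq

  nth-injective : ∀ {xs i j} → Unique xs → i < length xs → j < length xs →
                  nth d xs i ≡ nth d xs j → i ≡ j
  nth-injective {x ∷ xs} {zero}  {zero}  _        _       _       _  = refl
  nth-injective {x ∷ xs} {zero}  {suc j} (x∉ ∷ _) _ (s≤s q) eq = ⊥-elim (All.lookup x∉ (nth-∈ xs q) eq)
  nth-injective {x ∷ xs} {suc i} {zero}  (x∉ ∷ _) (s≤s p) _ eq = ⊥-elim (All.lookup x∉ (nth-∈ xs p) (sym eq))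
  nth-injective {x ∷ xs} {suc i} {suc j} (_ ∷ u)  (s≤s p) (s≤s q) eq = cong suc (nth-injective u p q eq)

  Linked⇒nth : ∀ {R : A → A → Set} {xs i} → Linked R xs → suc i < length xs →
               R (nth d xs i) (nth d xs (suc i))
  Linked⇒nth {i = zero}  (r ∷ _)  _       = r
  Linked⇒nth {i = suc i} (_ ∷ rs) (s≤s p) = Linked⇒nth rs p
  Linked⇒nth [-] (s≤s ())

  nth-++ˡ : ∀ xs {ys i} → i < length xs → nth d (xs ++ ys) i ≡ nth d xs i
  nth-++ˡ (x ∷ xs) {i = zero}  _       = refl
  nth-++ˡ (x ∷ xs) {i = suc i} (s≤s p) = nth-++ˡ xs p

  nth-∷ʳ-length : ∀ xs {y} → nth d (xs ∷ʳ y) (length xs) ≡ y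
  nth-∷ʳ-length []       = refl
  nth-∷ʳ-length (x ∷ xs) = nth-∷ʳ-length xs

  nth-extensional : ∀ xs ys → length xs ≡ length ys →
                    (∀ i → i < length xs → nth d xs i ≡ nth d ys i) → xs ≡ ys
  nth-extensional []       []       _  _  = refl
  nth-extensional (x ∷ xs) (y ∷ ys) eq f =
    cong₂ _∷_ (f 0 (s≤s z≤n)) (nth-extensional xs ys (suc-injective eq) (λ i p → f (suc i) (s≤s p)))

remQuot-injective : ∀ {n} k {i j : Fin (n * k)} → remQuot {n} k i ≡ remQuot k j → i ≡ j
remQuot-injective {n} k {i} {j} eq =
  trans (sym (combine-remQuot {n} k i)) (trans (cong (uncurry combine) eq) (combine-remQuot {n} k j))

-- Splits off the element at position j of x ∷ xs; a too large j selects the last one.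
select : A → List A → ℕ → A × List A
select x xs       zero    = x , xs
select x []       (suc j) = x , []
select x (y ∷ ys) (suc j) = let z , zs = select y ys j in z , x ∷ zs

select-↭ : ∀ (x : A) xs j → proj₁ (select x xs j) ∷ proj₂ (select x xs j) ↭ x ∷ xs
select-↭ x xs       zero    = ↭-refl
select-↭ x []       (suc j) = ↭-refl
select-↭ x (y ∷ ys) (suc j) = ↭-trans (↭-swap _ x ↭-refl) (↭-prep x (select-↭ y ys j))

select-∈ : ∀ (x : A) xs j → proj₁ (select x xs j) ∈ x ∷ xs
select-∈ x xs j = ↭.∈-resp-↭ (select-↭ x xs j) (here refl)

select-injective : ∀ {x : A} {xs j j′} → Unique (x ∷ xs) → j ≤ length xs → j′ ≤ length xs →
                   proj₁ (select x xs j) ≡ proj₁ (select x xs j′) → j ≡ j′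
select-injective {j = zero} {zero} _ _ _ _ = refl
select-injective {x = x} {y ∷ ys} {zero} {suc j′} (x∉ ∷ _) _ _ eq =
  ⊥-elim (All.lookup x∉ (select-∈ y ys j′) eq)
select-injective {x = x} {y ∷ ys} {suc j} {zero} (x∉ ∷ _) _ _ eq =
  ⊥-elim (All.lookup x∉ (select-∈ y ys j) (sym eq))
select-injective {xs = y ∷ ys} {suc j} {suc j′} (_ ∷ u) (s≤s p) (s≤s q) eq =
  cong suc (select-injective u p q eq)

arrangement : (n : ℕ) → List A → Fin (n !) → List A
arrangement zero    _        _ = []
arrangement (suc n) []       _ = []
arrangement (suc n) (x ∷ xs) i =
  let j , i′ = remQuot {suc n} (n !) i
      y , ys = select x xs (toℕ j)
  in y ∷ arrangement n ys i′

arrangement-↭ : ∀ n {xs : List A} i → length xs ≡ n → arrangement n xs i ↭ xs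
arrangement-↭ zero    {[]}     i _  = ↭-refl
arrangement-↭ (suc n) {x ∷ xs} i eq =
  ↭-trans (↭-prep _ (arrangement-↭ n _ (suc-injective (trans (↭.↭-length sel) eq)))) sel
  where sel = select-↭ x xs (toℕ (proj₁ (remQuot {suc n} (n !) i)))

arrangement-injective : ∀ n {xs : List A} {i j} → length xs ≡ n → Unique xs →
                        arrangement n xs i ≡ arrangement n xs j → i ≡ j
arrangement-injective zero    {[]}     {Fin.zero} {Fin.zero} _ _ _ = refl
arrangement-injective (suc n) {x ∷ xs} eq u eqA =
  remQuot-injective {suc n} (n !)
    (same-first (toℕ-injective (select-injective u (bound _) (bound _) (∷-injectiveˡ eqA))) eqA)
  where
    bound : (j : Fin (suc n)) → toℕ j ≤ length xs
    bound j = subst (toℕ j ≤_) (sym (suc-injective eq)) (≤-pred (toℕ<n j))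

    same-first : ∀ {j₁ j₂ : Fin (suc n)} {i₁ i₂} → j₁ ≡ j₂ →
      proj₁ (select x xs (toℕ j₁)) ∷ arrangement n (proj₂ (select x xs (toℕ j₁))) i₁ ≡
      proj₁ (select x xs (toℕ j₂)) ∷ arrangement n (proj₂ (select x xs (toℕ j₂))) i₂ →
      (j₁ , i₁) ≡ (j₂ , i₂)
    same-first {j₁} refl e =
      cong (j₁ ,_) (arrangement-injective n (suc-injective (trans (↭.↭-length sel) eq))
                      (tail (Unique-resp-↭ (↭-sym sel) u)) (∷-injectiveʳ e))
      where sel = select-↭ x xs (toℕ j₁)

layer : ∀ {m} → Fin 2 → List (Fin m) → List (V m)
layer ℓ = map (ℓ ,_)

allVertices : (m : ℕ) → List (V m)
allVertices m = cartesianProduct (allFin 2) (allFin m)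

length-allVertices : ∀ m → length (allVertices m) ≡ 2 * m
length-allVertices m = begin
  length (layer 0F (allFin m) ++ layer 1F (allFin m) ++ [])
    ≡⟨ length-++ (layer 0F (allFin m)) ⟩
  length (layer 0F (allFin m)) + length (layer 1F (allFin m) ++ [])
    ≡⟨ cong₂ _+_ (length-layer 0F) (trans (cong length (++-identityʳ (layer 1F (allFin m)))) (length-layer 1F)) ⟩
  m + m
    ≡⟨ cong (m +_) (sym (+-identityʳ m)) ⟩
  2 * m ∎
  where
    open ≡-Reasoning
    length-layer : ∀ ℓ → length (layer ℓ (allFin m)) ≡ m
    length-layer ℓ = trans (length-map _ (allFin m)) (length-tabulate _)

record HamCycleList (m : ℕ) (vs : List (V m)) : Set where
  field
    length≡  : length vs ≡ 2 * m
    unique   : Unique vs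
    complete : ∀ v → v ∈ vs
    cyclic   : CyclicallyLinked (Adj m) vs

spanning⇒HamCycleList : ∀ {m vs} → vs ↭ allVertices m → CyclicallyLinked (Adj m) vs → HamCycleList m vs
spanning⇒HamCycleList {m} p c = record
  { length≡  = trans (↭.↭-length p) (length-allVertices m)
  ; unique   = Unique-resp-↭ (↭-sym p) (Unique.cartesianProduct⁺ (Unique.allFin⁺ 2) (Unique.allFin⁺ m))
  ; complete = λ (ℓ , c) → ↭.∈-resp-↭ (↭-sym p) (∈-cartesianProduct⁺ (∈-allFin ℓ) (∈-allFin c))
  ; cyclic   = c
  }

HamCycleList-rotate : ∀ {m} xs ys → HamCycleList m (xs ++ ys) → HamCycleList m (ys ++ xs)
HamCycleList-rotate xs ys h = record
  { length≡  = trans (↭.↭-length (↭.++-comm ys xs)) length≡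
  ; unique   = Unique-resp-↭ (↭.++-comm xs ys) unique
  ; complete = λ v → ↭.∈-resp-↭ (↭.++-comm xs ys) (complete v)
  ; cyclic   = CyclicallyLinked-rotate xs ys cyclic
  }
  where open HamCycleList h

yes-witness : ∀ {P : Set} (p? : Dec P) → does p? ≡ true → P
yes-witness (yes p) _  = p
yes-witness (no _)  ()

cycSucc? : ∀ N (i j : Fin N) → Dec (CycSucc N i j)
cycSucc? N i j = (toℕ j ℕ.≟ suc (toℕ i)) ⊎-dec ((suc (toℕ i) ℕ.≟ N) ×-dec (toℕ j ℕ.≟ 0))

module CycleEdges {m} {a : V m} {r} (h : HamCycleList m (a ∷ r)) where

  open HamCycleList h

  private
    vs = a ∷ r
    N  = 2 * m

    bound : ∀ {i} → i < N → i < length vs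
    bound {i} = subst (i <_) (sym length≡)

    bound∷ʳ : ∀ {i} → i ≤ length vs → i < length (vs ∷ʳ a)
    bound∷ʳ {i} p = subst (i <_) (sym (trans (length-++ vs) (+-comm (length vs) 1))) (s≤s p)

  σ : Fin N → V m
  σ i = nth a vs (toℕ i)

  σ-injective : ∀ {i j} → σ i ≡ σ j → i ≡ j
  σ-injective {i} {j} eq = toℕ-injective (nth-injective a unique (bound (toℕ<n i)) (bound (toℕ<n j)) eq)

  position : V m → Fin N
  position v = let i , i< , _ = ∈⇒nth a vs (complete v) in fromℕ< (subst (i <_) length≡ i<)

  σ-position : ∀ v → σ (position v) ≡ v
  σ-position v with ∈⇒nth a vs (complete v)
  ... | i , i< , eq rewrite toℕ-fromℕ< (subst (i <_) length≡ i<) = eq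

  σ-CycSucc : ∀ i j → CycSucc N i j → Adj m (σ i) (σ j)
  σ-CycSucc i j (inj₁ j≡1+i) =
    subst₂ (Adj m) (nth-++ˡ a vs (bound (toℕ<n i)))
      (trans (nth-++ˡ a vs j<) (cong (nth a vs) (sym j≡1+i)))
      (Linked⇒nth a cyclic (bound∷ʳ (<⇒≤ j<)))
    where j< = subst (_< length vs) j≡1+i (bound (toℕ<n j))
  σ-CycSucc i j (inj₂ (1+i≡N , j≡0)) =
    subst₂ (Adj m) (nth-++ˡ a vs (bound (toℕ<n i)))
      (trans (cong (nth a (vs ∷ʳ a)) 1+i≡length) (trans (nth-∷ʳ-length a vs) (cong (nth a vs) (sym j≡0))))
      (Linked⇒nth a cyclic (bound∷ʳ (≤-reflexive 1+i≡length)))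
    where 1+i≡length = trans 1+i≡N (sym length≡)

  consecutive? : ∀ u v → Dec (CycSucc N (position u) (position v) ⊎ CycSucc N (position v) (position u))
  consecutive? u v = cycSucc? N (position u) (position v) ⊎-dec cycSucc? N (position v) (position u)

  edges : EdgeSet m
  edges u v = does (consecutive? u v)

  Consecutive : V m → V m → Set
  Consecutive u v = ∃ λ i → ∃ λ j → CycSucc N i j × ((u ≡ σ i × v ≡ σ j) ⊎ (v ≡ σ i × u ≡ σ j))

  position-σ : ∀ i → position (σ i) ≡ i
  position-σ i = σ-injective (σ-position (σ i))

  edges-sound : ∀ {u v} → edges u v ≡ true → Consecutive u v
  edges-sound {u} {v} e with yes-witness (consecutive? u v) e
  ... | inj₁ c = position u , position v , c , inj₁ (sym (σ-position u) , sym (σ-position v))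
  ... | inj₂ c = position v , position u , c , inj₂ (sym (σ-position v) , sym (σ-position u))

  edges-complete : ∀ {u v} → Consecutive u v → edges u v ≡ true
  edges-complete {u} {v} (i , j , c , uv) = dec-true (consecutive? u v) (witness uv)
    where
      c′ = subst₂ (CycSucc N) (sym (position-σ i)) (sym (position-σ j)) c
      witness : (u ≡ σ i × v ≡ σ j) ⊎ (v ≡ σ i × u ≡ σ j) →
                CycSucc N (position u) (position v) ⊎ CycSucc N (position v) (position u)
      witness (inj₁ (refl , refl)) = inj₁ c′
      witness (inj₂ (refl , refl)) = inj₂ c′

  isHamCycle : IsHamCycle m edges
  isHamCycle = σ , (λ _ _ → σ-injective) , (λ v → position v , σ-position v) , σ-CycSucc ,
               λ _ _ → mk⇔ edges-sound edges-complete

  edges-nth : ∀ i → suc i < N → edges (nth a vs i) (nth a vs (suc i)) ≡ true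
  edges-nth i p = edges-complete
    (fromℕ< i<N , fromℕ< p , inj₁ (trans (toℕ-fromℕ< p) (cong suc (sym (toℕ-fromℕ< i<N)))) ,
     inj₁ (cong (nth a vs) (sym (toℕ-fromℕ< i<N)) , cong (nth a vs) (sym (toℕ-fromℕ< p))))
    where i<N = <-trans (n<1+n i) p

  σ-index : ∀ {i} k → i < N → nth a vs i ≡ σ k → toℕ k ≡ i
  σ-index k i< eq = nth-injective a unique (bound (toℕ<n k)) (bound i<) (sym eq)

  nth-neighbours : ∀ i {w} → suc (suc i) < N → edges (nth a vs (suc i)) w ≡ true →
                   w ≡ nth a vs i ⊎ w ≡ nth a vs (suc (suc i))
  nth-neighbours i p e with edges-sound e
  ... | k , l , inj₁ l≡1+k , inj₁ (e₁ , e₂) =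
    inj₂ (trans e₂ (cong (nth a vs) (trans l≡1+k (cong suc (σ-index k (<-trans (n<1+n _) p) e₁)))))
  ... | k , l , inj₂ (1+k≡N , _) , inj₁ (e₁ , _) =
    ⊥-elim (<-irrefl (trans (cong suc (sym (σ-index k (<-trans (n<1+n _) p) e₁))) 1+k≡N) p)
  ... | k , l , inj₁ l≡1+k , inj₂ (e₂ , e₁) =
    inj₁ (trans e₂ (cong (nth a vs) (suc-injective (trans (sym l≡1+k) (σ-index l (<-trans (n<1+n _) p) e₁)))))
  ... | k , l , inj₂ (_ , l≡0) , inj₂ (_ , e₁) with () ← trans (sym (σ-index l (<-trans (n<1+n _) p) e₁)) l≡0

-- Each further vertex is the neighbour of the previous one other than the one before it.
edges-injective : ∀ {m a b r r′} (h : HamCycleList m (a ∷ b ∷ r)) (h′ : HamCycleList m (a ∷ b ∷ r′)) →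
                  (∀ u v → CycleEdges.edges h u v ≡ CycleEdges.edges h′ u v) → r ≡ r′
edges-injective {m} {a} {b} {r} {r′} h h′ same =
  ∷-injectiveʳ (∷-injectiveʳ (nth-extensional a vs vs′ (trans (H.length≡ h) (sym (H.length≡ h′)))
                                (λ i p → proj₁ (agree i) (subst (i <_) (H.length≡ h) p))))
  where
    module H = HamCycleList
    module C = CycleEdges h
    module C′ = CycleEdges h′
    vs vs′ : List (V m)
    vs = a ∷ b ∷ r
    vs′ = a ∷ b ∷ r′

    bound : ∀ {i} → i < 2 * m → i < length vs
    bound {i} = subst (i <_) (sym (H.length≡ h))

    Agree : ℕ → Set
    Agree i = i < 2 * m → nth a vs i ≡ nth a vs′ i

    step : ∀ i → suc (suc i) < 2 * m → nth a vs i ≡ nth a vs′ i → nth a vs (suc i) ≡ nth a vs′ (suc i) →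
           nth a vs (suc (suc i)) ≡ nth a vs′ (suc (suc i))
    step i p e₀ e₁
      with C′.nth-neighbours i p (trans (cong (λ x → C′.edges x _) (sym e₁))
                                         (trans (sym (same _ _)) (C.edges-nth (suc i) p)))
    ... | inj₂ e = e
    ... | inj₁ e with () ← nth-injective a {xs = vs} {i = suc (suc i)} {j = i} (H.unique h) (bound p)
                            (bound (<-trans (n<1+n _) (<-trans (n<1+n _) p))) (trans e (sym e₀))

    agree : ∀ i → Agree i × Agree (suc i)
    agree zero    = (λ _ → refl) , (λ _ → refl)
    agree (suc i) = let A₀ , A₁ = agree i in
      A₁ , λ p → step i p (A₀ (<-trans (n<1+n _) (<-trans (n<1+n _) p))) (A₁ (<-trans (n<1+n _) p))

permutation-injective : ∀ {n} (π : Permutation′ n) {i j} → π ⟨$⟩ʳ i ≡ π ⟨$⟩ʳ j → i ≡ j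
permutation-injective π eq = trans (sym (inverseˡ π)) (trans (cong (π ⟨$⟩ˡ_) eq) (inverseˡ π))

module Relabel {m} (π : Permutation′ 2) (ρ : Permutation′ m) where

  relabel : V m → V m
  relabel (ℓ , c) = π ⟨$⟩ʳ ℓ , ρ ⟨$⟩ʳ c

  relabel-injective : ∀ {u v} → relabel u ≡ relabel v → u ≡ v
  relabel-injective eq =
    cong₂ _,_ (permutation-injective π (cong proj₁ eq)) (permutation-injective ρ (cong proj₂ eq))

  relabel-Adj : ∀ {u v} → Adj m u v → Adj m (relabel u) (relabel v)
  relabel-Adj (inj₁ (eq , ne)) = inj₁ (cong (π ⟨$⟩ʳ_) eq , ne ∘ permutation-injective ρ)
  relabel-Adj (inj₂ (ne , eq)) = inj₂ (ne ∘ permutation-injective π , cong (ρ ⟨$⟩ʳ_) eq)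

  HamCycleList-relabel : ∀ {vs} → HamCycleList m vs → HamCycleList m (map relabel vs)
  HamCycleList-relabel {vs} h = record
    { length≡  = trans (length-map relabel vs) length≡
    ; unique   = Unique.map⁺ relabel-injective unique
    ; complete = λ (ℓ , c) → subst (_∈ map relabel vs) (cong₂ _,_ (inverseʳ π) (inverseʳ ρ))
                               (∈-map⁺ relabel (complete (π ⟨$⟩ˡ ℓ , ρ ⟨$⟩ˡ c)))
    ; cyclic   = CyclicallyLinked-map relabel-Adj vs cyclic
    }
    where open HamCycleList h

layer-Linked : ∀ {m} ℓ {cs : List (Fin m)} → Unique cs → Linked (Adj m) (layer ℓ cs)
layer-Linked ℓ u = Linked.map⁺ (Linked.map (λ ne → inj₁ (refl , ne)) (Linked.AllPairs⇒Linked u))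

rung : ∀ {m ℓ ℓ′} (c : Fin m) → ℓ ≢ ℓ′ → Adj m (ℓ , c) (ℓ′ , c)
rung c ne = inj₂ (ne , refl)

twoLayerCycle : ∀ {m c d} A B → c ∷ A ∷ʳ d ↭ allFin m → d ∷ B ∷ʳ c ↭ allFin m →
                HamCycleList m (layer 0F (c ∷ A ∷ʳ d) ++ layer 1F (d ∷ B ∷ʳ c))
twoLayerCycle {m} {c} {d} A B p₀ p₁ = spanning⇒HamCycleList spans (subst (Linked (Adj m)) eq walk)
  where
    spans : layer 0F (c ∷ A ∷ʳ d) ++ layer 1F (d ∷ B ∷ʳ c) ↭ allVertices m
    spans = ↭.++⁺ (↭.map⁺ _ p₀) (↭-trans (↭.map⁺ _ p₁) (↭-reflexive (sym (++-identityʳ _))))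

    path : ∀ ℓ x xs y → x ∷ xs ∷ʳ y ↭ allFin m → Linked (Adj m) (layer ℓ (x ∷ xs) ∷ʳ (ℓ , y))
    path ℓ x xs y p = subst (Linked (Adj m)) (map-++ (ℓ ,_) (x ∷ xs) [ y ])
                        (layer-Linked ℓ (Unique-resp-↭ (↭-sym p) (Unique.allFin⁺ m)))

    walk : Linked (Adj m) (layer 0F (c ∷ A) ++ (0F , d) ∷ (1F , d) ∷ layer 1F B ++ (1F , c) ∷ (0F , c) ∷ [])
    walk = Linked-bridge (layer 0F (c ∷ A)) (path 0F c A d p₀) (rung d λ ())
             (Linked-bridge (layer 1F (d ∷ B)) (path 1F d B c p₁) (rung c λ ()) [-])

    eq : layer 0F (c ∷ A) ++ (0F , d) ∷ (1F , d) ∷ layer 1F B ++ (1F , c) ∷ (0F , c) ∷ []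
       ≡ (0F , c) ∷ (layer 0F (A ∷ʳ d) ++ layer 1F (d ∷ B ∷ʳ c)) ∷ʳ (0F , c)
    eq = cong ((0F , c) ∷_) (sym (begin
      (layer 0F (A ∷ʳ d) ++ (1F , d) ∷ layer 1F (B ∷ʳ c)) ∷ʳ (0F , c)
        ≡⟨ cong₂ (λ xs ys → (xs ++ (1F , d) ∷ ys) ∷ʳ (0F , c)) (map-++ _ A [ d ]) (map-++ _ B [ c ]) ⟩
      ((layer 0F A ∷ʳ (0F , d)) ++ (1F , d) ∷ (layer 1F B ∷ʳ (1F , c))) ∷ʳ (0F , c)
        ≡⟨ ++-assoc (layer 0F A ∷ʳ (0F , d)) _ _ ⟩
      (layer 0F A ∷ʳ (0F , d)) ++ (1F , d) ∷ (layer 1F B ∷ʳ (1F , c)) ∷ʳ (0F , c)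
        ≡⟨ ++-assoc (layer 0F A) _ _ ⟩
      layer 0F A ++ (0F , d) ∷ (1F , d) ∷ (layer 1F B ∷ʳ (1F , c)) ∷ʳ (0F , c)
        ≡⟨ cong (λ xs → layer 0F A ++ (0F , d) ∷ (1F , d) ∷ xs) (++-assoc (layer 1F B) _ _) ⟩
      layer 0F A ++ (0F , d) ∷ (1F , d) ∷ layer 1F B ++ (1F , c) ∷ (0F , c) ∷ [] ∎))
      where open ≡-Reasoning

layer-++-injective : ∀ {m ℓ ℓ′} → ℓ ≢ ℓ′ → ∀ (xs xs′ : List (Fin m)) {y y′ zs zs′} →
                     layer ℓ xs ++ (ℓ′ , y) ∷ zs ≡ layer ℓ xs′ ++ (ℓ′ , y′) ∷ zs′ →
                     xs ≡ xs′ × y ≡ y′ × zs ≡ zs′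
layer-++-injective ne []       []         refl = refl , refl , refl
layer-++-injective ne []       (x′ ∷ xs′) eq   = ⊥-elim (ne (sym (cong proj₁ (∷-injectiveˡ eq))))
layer-++-injective ne (x ∷ xs) []         eq   = ⊥-elim (ne (cong proj₁ (∷-injectiveˡ eq)))
layer-++-injective ne (x ∷ xs) (x′ ∷ xs′) eq   =
  let xs≡ , rest≡ = layer-++-injective ne xs xs′ (∷-injectiveʳ eq)
  in cong₂ _∷_ (cong proj₂ (∷-injectiveˡ eq)) xs≡ , rest≡

HamCyclesThrough : (m N : ℕ) → V m → V m → Set
HamCyclesThrough m N u v =
  Σ (Fin N → EdgeSet m) λ H →
    (∀ k → IsHamCycle m (H k) × H k u v ≡ true) × (∀ k l → k ≢ l → H k ≢ H l)

record CycleFamily (m N : ℕ) (a b : V m) : Set where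
  field
    rest           : Fin N → List (V m)
    isCycle        : ∀ k → HamCycleList m (a ∷ b ∷ rest k)
    rest-injective : ∀ {k l} → rest k ≡ rest l → k ≡ l

CycleFamily⇒HamCyclesThrough : ∀ {m N a b} → CycleFamily m N a b → HamCyclesThrough m N a b
CycleFamily⇒HamCyclesThrough {m} F =
  (λ k → CycleEdges.edges (isCycle k)) ,
  (λ k → CycleEdges.isHamCycle (isCycle k) ,
         CycleEdges.edges-nth (isCycle k) 0 (subst (1 <_) (HamCycleList.length≡ (isCycle k)) (s≤s (s≤s z≤n)))) ,
  λ k l k≢l eq → k≢l (rest-injective (edges-injective (isCycle k) (isCycle l) (λ u v → cong (λ H → H u v) eq)))
  where open CycleFamily F

CycleFamily-relabel : ∀ {m N a b} (π : Permutation′ 2) (ρ : Permutation′ m) → CycleFamily m N a b →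
                      let open Relabel π ρ in CycleFamily m N (relabel a) (relabel b)
CycleFamily-relabel π ρ F = record
  { rest           = map relabel ∘ rest
  ; isCycle        = HamCycleList-relabel ∘ isCycle
  ; rest-injective = rest-injective ∘ map-injective relabel-injective
  }
  where open CycleFamily F; open Relabel π ρ

module _ (k : ℕ) where

  private
    m = suc (suc k)

  T : List (Fin m)
  T = tabulate (λ i → Fin.suc (Fin.suc i))

  length-T : length T ≡ k
  length-T = length-tabulate _

  unique-allFin : Unique (0F ∷ 1F ∷ T)
  unique-allFin = Unique.allFin⁺ m

  toℕ≤length-T : (j : Fin (suc k)) → toℕ j ≤ length T
  toℕ≤length-T j = subst (toℕ j ≤_) (sym length-T) (≤-pred (toℕ<n j))

  index : Fin (suc k ! * k !) → Fin (suc k) × Fin (k !) × Fin (k !)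
  index i = let p , r = remQuot {suc k !} (k !) i; j , s = remQuot {suc k} (k !) p in j , s , r

  index-injective : ∀ {i i′} → index i ≡ index i′ → i ≡ i′
  index-injective {i} {i′} eq =
    remQuot-injective {suc k !} (k !)
      (cong₂ _,_ (remQuot-injective {suc k} (k !) (cong₂ _,_ (cong proj₁ eq) (cong (proj₁ ∘ proj₂) eq)))
                 (cong (proj₂ ∘ proj₂) eq))

  -- Cycles through the rung at 0F crossing back at the column d; M₀ and M₁ order the
  -- remaining columns in the two layers independently.
  module Rung (j : Fin (suc k)) (s r : Fin (k !)) where

    d : Fin m
    d = proj₁ (select 1F T (toℕ j))

    D M₀ M₁ : List (Fin m)
    D = proj₂ (select 1F T (toℕ j))
    M₀ = arrangement k D s
    M₁ = arrangement k M₀ r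

    rest : List (V m)
    rest = layer 0F (M₀ ∷ʳ d) ++ layer 1F (d ∷ M₁)

    dD↭ : d ∷ D ↭ 1F ∷ T
    dD↭ = select-↭ 1F T (toℕ j)

    length-D : length D ≡ k
    length-D = suc-injective (trans (↭.↭-length dD↭) (cong suc length-T))

    M₀↭D : M₀ ↭ D
    M₀↭D = arrangement-↭ k s length-D

    length-M₀ : length M₀ ≡ k
    length-M₀ = trans (↭.↭-length M₀↭D) length-D

    unique-D : Unique D
    unique-D = tail (Unique-resp-↭ (↭-sym dD↭) (tail unique-allFin))

    unique-M₀ : Unique M₀
    unique-M₀ = Unique-resp-↭ (↭-sym M₀↭D) unique-D

    layer₀↭ : 0F ∷ M₀ ∷ʳ d ↭ allFin m
    layer₀↭ = begin
      0F ∷ M₀ ∷ʳ d  ↭⟨ ↭-prep 0F (↭-sym (↭.∷↭∷ʳ d M₀)) ⟩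
      0F ∷ d ∷ M₀   ↭⟨ ↭-prep 0F (↭-prep d M₀↭D) ⟩
      0F ∷ d ∷ D   ↭⟨ ↭-prep 0F dD↭ ⟩
      0F ∷ 1F ∷ T  ∎
      where open PermutationReasoning

    layer₁↭ : d ∷ M₁ ∷ʳ 0F ↭ allFin m
    layer₁↭ = ↭-trans (∷-∷ʳ-↭ (arrangement-↭ k r length-M₀)) layer₀↭

    isCycle : HamCycleList m ((1F , 0F) ∷ (0F , 0F) ∷ rest)
    isCycle = HamCycleList-rotate _ [ (1F , 0F) ]
                (subst (HamCycleList m) split (twoLayerCycle M₀ M₁ layer₀↭ layer₁↭))
      where
        split : layer 0F (0F ∷ M₀ ∷ʳ d) ++ layer 1F (d ∷ M₁ ∷ʳ 0F) ≡ ((0F , 0F) ∷ rest) ∷ʳ (1F , 0F)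
        split = trans (cong (layer 0F (0F ∷ M₀ ∷ʳ d) ++_) (map-++ _ (d ∷ M₁) [ 0F ]))
                      (sym (++-assoc (layer 0F (0F ∷ M₀ ∷ʳ d)) (layer 1F (d ∷ M₁)) _))

  rung-injective : ∀ {j s r j′ s′ r′} → Rung.rest j s r ≡ Rung.rest j′ s′ r′ →
                   (j , s , r) ≡ (j′ , s′ , r′)
  rung-injective {j} {s} {r} {j′} {s′} {r′} eq =
    let M₀d≡ , _ , lM₁≡ = layer-++-injective (λ ()) (Rung.M₀ j s r ∷ʳ Rung.d j s r) _ eq
        M₀≡ , d≡ = ∷ʳ-injective (Rung.M₀ j s r) _ M₀d≡
    in same-d (toℕ-injective (select-injective (tail unique-allFin) (toℕ≤length-T j) (toℕ≤length-T j′) d≡))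
              M₀≡ (map-injective (cong proj₂) lM₁≡)
    where
      same-d : j ≡ j′ → Rung.M₀ j s r ≡ Rung.M₀ j′ s′ r′ → Rung.M₁ j s r ≡ Rung.M₁ j′ s′ r′ →
               (j , s , r) ≡ (j′ , s′ , r′)
      same-d refl M₀≡ M₁≡ with refl ← arrangement-injective k (Rung.length-D j s r) (Rung.unique-D j s r) M₀≡ =
        cong (λ r → j , s , r) (arrangement-injective k (Rung.length-M₀ j s r) (Rung.unique-M₀ j s r) M₁≡)

  -- Cycles through the edge (0,0F)(0,1F): layer 0 is traversed along X ++ 0F ∷ 1F ∷ Y, where
  -- the ordering S = X ++ Y of the other columns is cut after j entries; the cycle crosses to
  -- layer 1 at the last column d of this sequence, visits the remaining columns there in an
  -- arbitrary order M₁ and returns at the first column c.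
  module Top (j : Fin (suc k)) (s r : Fin (k !)) where

    S X Y : List (Fin m)
    S = arrangement k T s
    X = take (toℕ j) S
    Y = drop (toℕ j) S

    c d : Fin m
    c = proj₁ (headTail-∷ʳ X 0F)
    d = proj₂ (initLast-∷ 1F Y)

    M₀ M₁ : List (Fin m)
    M₀ = proj₂ (headTail-∷ʳ X 0F) ++ proj₁ (initLast-∷ 1F Y)
    M₁ = arrangement k M₀ r

    rest : List (V m)
    rest = layer 0F Y ++ layer 1F (d ∷ M₁ ∷ʳ c) ++ layer 0F X

    layer₀≡ : c ∷ M₀ ∷ʳ d ≡ X ++ 0F ∷ 1F ∷ Y
    layer₀≡ = begin
      c ∷ (X₀ ++ Y₀) ∷ʳ d    ≡⟨ cong (c ∷_) (++-assoc X₀ Y₀ [ d ]) ⟩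
      (c ∷ X₀) ++ (Y₀ ∷ʳ d)  ≡⟨ cong₂ _++_ (sym (headTail-∷ʳ-≡ X 0F)) (sym (initLast-∷-≡ 1F Y)) ⟩
      X ∷ʳ 0F ++ 1F ∷ Y      ≡⟨ ++-assoc X [ 0F ] (1F ∷ Y) ⟩
      X ++ 0F ∷ 1F ∷ Y       ∎
      where
        open ≡-Reasoning
        X₀ = proj₂ (headTail-∷ʳ X 0F)
        Y₀ = proj₁ (initLast-∷ 1F Y)

    S↭T : S ↭ T
    S↭T = arrangement-↭ k s length-T

    layer₀↭ : c ∷ M₀ ∷ʳ d ↭ allFin m
    layer₀↭ = begin
      c ∷ M₀ ∷ʳ d         ≡⟨ layer₀≡ ⟩
      X ++ 0F ∷ 1F ∷ Y   ↭⟨ ↭.shift 0F X (1F ∷ Y) ⟩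
      0F ∷ X ++ 1F ∷ Y   ↭⟨ ↭-prep 0F (↭.shift 1F X Y) ⟩
      0F ∷ 1F ∷ X ++ Y   ≡⟨ cong (λ xs → 0F ∷ 1F ∷ xs) (take++drop≡id (toℕ j) S) ⟩
      0F ∷ 1F ∷ S        ↭⟨ ↭-prep 0F (↭-prep 1F S↭T) ⟩
      0F ∷ 1F ∷ T        ∎
      where open PermutationReasoning

    length-S : length S ≡ k
    length-S = trans (↭.↭-length S↭T) length-T

    length-M₀ : length M₀ ≡ k
    length-M₀ = suc-injective (suc-injective (begin
      suc (suc (length M₀))  ≡⟨ cong suc (length-∷ʳ M₀) ⟨
      length (c ∷ M₀ ∷ʳ d)   ≡⟨ ↭.↭-length layer₀↭ ⟩
      length (allFin m)      ≡⟨ length-tabulate {n = m} (λ i → i) ⟩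
      m                      ∎))
      where open ≡-Reasoning

    unique-M₀ : Unique M₀
    unique-M₀ = tail (Unique-resp-↭ (↭-sym (↭.∷↭∷ʳ d M₀))
                       (tail (Unique-resp-↭ (↭-sym layer₀↭) (Unique.allFin⁺ m))))

    M₁↭M₀ : M₁ ↭ M₀
    M₁↭M₀ = arrangement-↭ k r length-M₀

    length-M₁ : length M₁ ≡ k
    length-M₁ = trans (↭.↭-length M₁↭M₀) length-M₀

    isCycle : HamCycleList m ((0F , 0F) ∷ (0F , 1F) ∷ rest)
    isCycle = subst (HamCycleList m) (cong (λ xs → (0F , 0F) ∷ (0F , 1F) ∷ xs) (++-assoc (layer 0F Y) _ _))
                (HamCycleList-rotate (layer 0F X) _ (subst (HamCycleList m) split
                  (twoLayerCycle M₀ M₁ layer₀↭ (↭-trans (∷-∷ʳ-↭ M₁↭M₀) layer₀↭))))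
      where
        L₁ = layer 1F (d ∷ M₁ ∷ʳ c)
        split : layer 0F (c ∷ M₀ ∷ʳ d) ++ L₁ ≡ layer 0F X ++ (layer 0F (0F ∷ 1F ∷ Y) ++ L₁)
        split = trans (cong (λ xs → layer 0F xs ++ L₁) layer₀≡)
                  (trans (cong (_++ L₁) (map-++ _ X (0F ∷ 1F ∷ Y))) (++-assoc (layer 0F X) _ _))

  top-injective : ∀ {j s r j′ s′ r′} → Top.rest j s r ≡ Top.rest j′ s′ r′ →
                  (j , s , r) ≡ (j′ , s′ , r′)
  top-injective {j} {s} {r} {j′} {s′} {r′} eq =
    let Y≡ , _ , eq′ = layer-++-injective (λ ()) (Top.Y j s r) (Top.Y j′ s′ r′) eq
        lM₁c≡ , lX≡ = ++-injective (layer 1F (Top.M₁ j s r ∷ʳ Top.c j s r)) _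
                       (trans (length-layer₁ j s r) (sym (length-layer₁ j′ s′ r′))) eq′
        X≡ = map-injective (cong proj₂) lX≡
        S≡ = trans (sym (take++drop≡id (toℕ j) _)) (trans (cong₂ _++_ X≡ Y≡) (take++drop≡id (toℕ j′) _))
    in same-split (toℕ-injective (trans (sym (length-X j s r)) (trans (cong length X≡) (length-X j′ s′ r′))))
                  (arrangement-injective k length-T (tail (tail unique-allFin)) S≡)
                  (proj₁ (∷ʳ-injective _ _ (map-injective (cong proj₂) lM₁c≡)))
    where
      length-layer₁ : ∀ j s r → length (layer 1F (Top.M₁ j s r ∷ʳ Top.c j s r)) ≡ suc k
      length-layer₁ j s r = trans (length-map _ (Top.M₁ j s r ∷ʳ _))
                              (trans (length-∷ʳ (Top.M₁ j s r)) (cong suc (Top.length-M₁ j s r)))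

      length-X : ∀ j s r → length (Top.X j s r) ≡ toℕ j
      length-X j s r = trans (length-take (toℕ j) (Top.S j s r))
        (m≤n⇒m⊓n≡m (subst (toℕ j ≤_) (sym (Top.length-S j s r)) (≤-pred (toℕ<n j))))

      same-split : j ≡ j′ → s ≡ s′ → Top.M₁ j s r ≡ Top.M₁ j′ s′ r′ →
                   (j , s , r) ≡ (j′ , s′ , r′)
      same-split refl refl M₁≡ =
        cong (λ r → j , s , r) (arrangement-injective k (Top.length-M₀ j s r) (Top.unique-M₀ j s r) M₁≡)

  rungFamily : CycleFamily m (suc k ! * k !) (1F , 0F) (0F , 0F)
  rungFamily = record
    { rest           = λ i → let j , s , r = index i in Rung.rest j s r
    ; isCycle        = λ i → let j , s , r = index i in Rung.isCycle j s r
    ; rest-injective = index-injective ∘ rung-injective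
    }

  topFamily : CycleFamily m (suc k ! * k !) (0F , 0F) (0F , 1F)
  topFamily = record
    { rest           = λ i → let j , s , r = index i in Top.rest j s r
    ; isCycle        = λ i → let j , s , r = index i in Top.isCycle j s r
    ; rest-injective = index-injective ∘ top-injective
    }

transpose-matchˡ : ∀ {n} (i j : Fin n) → PC.transpose i j i ≡ j
transpose-matchˡ i j rewrite dec-true (i ≟ i) refl = refl

transpose-fixes : ∀ {n} {i j k : Fin n} → k ≢ i → k ≢ j → PC.transpose i j k ≡ k
transpose-fixes {i = i} {j} {k} k≢i k≢j rewrite dec-false (k ≟ i) k≢i | dec-false (k ≟ j) k≢j = refl

transpose-other : ∀ {ℓ ℓ′ : Fin 2} → ℓ ≢ ℓ′ → PC.transpose 1F ℓ 0F ≡ ℓ′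
transpose-other {0F} {0F} ne = ⊥-elim (ne refl)
transpose-other {0F} {1F} _  = refl
transpose-other {1F} {0F} _  = refl
transpose-other {1F} {1F} ne = ⊥-elim (ne refl)

module _ {k : ℕ} (c d : Fin (suc (suc k))) where

  private d′ = PC.transpose c 0F d

  sendPair : Permutation′ (suc (suc k))
  sendPair = transpose 1F d′ ∘ₚ transpose 0F c

  sendPair-0F : c ≢ d → sendPair ⟨$⟩ʳ 0F ≡ c
  sendPair-0F c≢d = trans (cong (PC.transpose 0F c) (transpose-fixes {i = 1F} (λ ()) 0F≢d′)) (transpose-matchˡ 0F c)
    where
      0F≢d′ : 0F ≢ d′
      0F≢d′ eq = c≢d (trans (sym (transpose-matchˡ 0F c))
                            (trans (cong (PC.transpose 0F c) eq) (PC.transpose-inverse 0F c)))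

  sendPair-1F : sendPair ⟨$⟩ʳ 1F ≡ d
  sendPair-1F = trans (cong (PC.transpose 0F c) (transpose-matchˡ 1F d′)) (PC.transpose-inverse 0F c)

proposition2p12 : (n : ℕ) → 3 ≤ n → (u v : V (n ∸ 1)) → Adj (n ∸ 1) u v →
    Σ (Fin (((n ∸ 2) !) * ((n ∸ 3) !)) → EdgeSet (n ∸ 1)) λ H →
      (∀ k → IsHamCycle (n ∸ 1) (H k) × H k u v ≡ true)
      × (∀ k l → k ≢ l → H k ≢ H l)
proposition2p12 (suc (suc (suc k))) (s≤s (s≤s (s≤s _))) (ℓ , c) (.ℓ , d) (inj₁ (refl , c≢d)) =
  subst₂ (HamCyclesThrough _ _) (cong₂ _,_ (transpose-matchˡ 0F ℓ) (sendPair-0F c d c≢d))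
                                (cong₂ _,_ (transpose-matchˡ 0F ℓ) (sendPair-1F c d))
    (CycleFamily⇒HamCyclesThrough (CycleFamily-relabel (transpose 0F ℓ) (sendPair c d) (topFamily k)))
proposition2p12 (suc (suc (suc k))) (s≤s (s≤s (s≤s _))) (ℓ , c) (ℓ′ , .c) (inj₂ (ℓ≢ℓ′ , refl)) =
  subst₂ (HamCyclesThrough _ _) (cong₂ _,_ (transpose-matchˡ 1F ℓ) (transpose-matchˡ 0F c))
                                (cong₂ _,_ (transpose-other ℓ≢ℓ′) (transpose-matchˡ 0F c))
    (CycleFamily⇒HamCyclesThrough (CycleFamily-relabel (transpose 1F ℓ) (transpose 0F c) (rungFamily k)))
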